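{- Let $G$ be a connected triangle-covered graph of order $n$, where $n=3q+r>3$ with integers $q\ge 1$ and $0\le r<3$. Then $|E(G)|\ge 4q-1+\epsilon_r$, where $\epsilon_r=\frac{r(5-r)}{2}$ (so $\epsilon_0=0$, $\epsilon_1=2$, $\epsilon_2=3$).
   Context: All graphs are finite and simple. A graph is triangle-covered if every vertex belongs to at least one triangle (a copy of $K_3$ as a subgraph). The order of a graph is its number of vertices. -}

module Defs where

open import Data.Nat using (ℕ; zero; suc; _+_; _*_; _∸_; _<_; _≤_)
open import Data.Nat.DivMod using (_/_)
open import Data.Bool using (Bool; true; false; if_then_else_)
open import Data.Fin using (Fin; toℕ)
open import Data.List using (List; []; _∷_; map; allFin; filter)
open import Data.Nat.ListAction using (sum)
open import Data.Product using (Σ; _×_; ∃-syntax)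
open import Data.Nat using (_<?_)
open import Relation.Binary.PropositionalEquality using (_≡_)
open import Relation.Nullary using (¬_)

record Graph (n : ℕ) : Set where
  field
    adj   : Fin n → Fin n → Bool
    sym   : ∀ u v → adj u v ≡ adj v u
    irrefl : ∀ v → adj v v ≡ false

open Graph public

Adj : ∀ {n} → Graph n → Fin n → Fin n → Set
Adj G u v = adj G u v ≡ true

edgeCount : ∀ {n} → Graph n → ℕ
edgeCount {n} G =
  sum (map (λ u → sum (map (λ v → if adj G u v then 1 else 0)
                           (filter (λ v → toℕ u <? toℕ v) (allFin n))))
           (allFin n))

data Walk {n : ℕ} (G : Graph n) : Fin n → Fin n → Set where
  here  : ∀ {u} → Walk G u u
  step  : ∀ {u v w} → Adj G u v → Walk G v w → Walk G u w

Connected : ∀ {n} → Graph n → Set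
Connected {n} G = ∀ (u v : Fin n) → Walk G u v

TriangleCovered : ∀ {n} → Graph n → Set
TriangleCovered {n} G =
  ∀ (v : Fin n) → ∃[ a ] ∃[ b ] (Adj G v a × Adj G v b × Adj G a b)

ε : ℕ → ℕ
ε r = (r * (5 ∸ r)) / 2

{-# OPTIONS --safe #-}
-- Grow a vertex set S, starting from a triangle, while keeping 4 ∣S∣ ≤ 3 e(S) + 3, where e(S)
-- is the number of edges inside S; the triangle attains this with equality. While S is not
-- everything, connectivity gives an edge sv leaving S, and a triangle vab through v lets us add
-- v and whichever of a, b lie outside S: one vertex and two edges, two vertices and three edges,
-- or (using sv) three vertices and four edges. Each step adds k vertices and at least 4k/3 edges,
-- so finally 4n ≤ 3∣E∣ + 3, i.e. ∣E∣ ≥ ⌈(4n − 3)/3⌉ = 4q − 1 + ε r.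
module Submission where

open import Defs
open import Data.Nat using (ℕ; suc; _+_; _*_; _∸_; _<_; _≤_; z≤n; s≤s; _<?_)
open import Data.Nat.Properties
open import Algebra.Properties.CommutativeSemigroup +-commutativeSemigroup using (interchange)
open import Data.Nat.ListAction using (sum)
open import Data.Bool using (true; false; if_then_else_; _∧_)
open import Data.Bool.Properties using (∧-comm; ∧-zeroʳ; ¬-not)
open import Data.Fin using (Fin; toℕ; fromℕ<)
open import Data.Fin.Properties using (all?; ¬∀⟶∃¬) renaming (<-cmp to <-cmpᶠ)
open import Data.Fin.Subset using (Subset; ⊥; ⊤; ⁅_⁆; _∪_; _∈_; _∉_; _⊆_; _⊂_; _⊃_; ∣_∣)
open import Data.Fin.Subset.Properties
  using (_∈?_; ∉⊥; p⊆p∪q; x∈p∪q⁺; x∈p∪q⁻; x∈⁅x⁆; x∈⁅y⁆⇒x≡y; ⊂-trans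
        ; ∣⊥∣≡0; ∣⊤∣≡n; ∣⁅x⁆∣≡1; ∣p∣≤∣x∷p∣; p⊆q⇒∣p∣≤∣q∣)
open import Data.Fin.Subset.Induction using (⊃-wellFounded)
open import Data.List using (List; []; _∷_; map; allFin; filter)
open import Data.List.Properties using (map-cong)
open import Data.List.Membership.Propositional using () renaming (_∈_ to _∈ₗ_)
open import Data.List.Membership.Propositional.Properties using (∈-allFin; ∈-filter⁺)
open import Data.List.Relation.Unary.Any using (here; there)
open import Data.Product using (_×_; _,_; ∃; ∃₂; proj₁)
open import Function using (_∘_)
open import Data.Sum using (inj₁; inj₂)
open import Data.Vec using ([]; _∷_)
open import Induction.WellFounded using (Acc; acc)
open import Level using (Level)
open import Relation.Binary using (tri<; tri≈; tri>)
open import Relation.Binary.PropositionalEquality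
  using (_≡_; _≢_; refl; trans; cong; cong₂; subst; subst₂) renaming (sym to ≡-sym)
open import Relation.Nullary using (¬_; yes; no; does; contradiction)
open import Relation.Nullary.Decidable using (dec-true; dec-false)
open import Relation.Unary using (Pred; Decidable)
open import Data.Nat.Tactic.RingSolver using (solve-∀)

module _ {A : Set} where

  sum-map-+ : (f g : A → ℕ) (xs : List A) →
              sum (map (λ x → f x + g x) xs) ≡ sum (map f xs) + sum (map g xs)
  sum-map-+ f g []       = refl
  sum-map-+ f g (x ∷ xs) =
    trans (cong (f x + g x +_) (sum-map-+ f g xs)) (interchange (f x) (g x) _ _)

  sum-map-mono : {f g : A → ℕ} (xs : List A) → (∀ x → f x ≤ g x) →
                 sum (map f xs) ≤ sum (map g xs)
  sum-map-mono []       f≤g = z≤n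
  sum-map-mono (x ∷ xs) f≤g = +-mono-≤ (f≤g x) (sum-map-mono xs f≤g)

  sum-map-≥-∈ : (f : A → ℕ) {x : A} {xs : List A} → x ∈ₗ xs → f x ≤ sum (map f xs)
  sum-map-≥-∈ f (here refl)            = m≤m+n _ _
  sum-map-≥-∈ f {xs = y ∷ _} (there p) = ≤-trans (sum-map-≥-∈ f p) (m≤n+m _ (f y))

  sum-map-≥-two : (f : A → ℕ) {x y : A} {xs : List A} → x ∈ₗ xs → y ∈ₗ xs → x ≢ y →
                  f x + f y ≤ sum (map f xs)
  sum-map-≥-two f (here refl) (here refl) x≢y = contradiction refl x≢y
  sum-map-≥-two f {x} (here refl) (there q) _ = +-monoʳ-≤ (f x) (sum-map-≥-∈ f q)
  sum-map-≥-two f {x} {y} {y ∷ xs} (there p) (here refl) _ =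
    subst (_≤ f y + sum (map f xs)) (+-comm (f y) (f x)) (+-monoʳ-≤ (f y) (sum-map-≥-∈ f p))
  sum-map-≥-two f {xs = z ∷ _} (there p) (there q) x≢y =
    ≤-trans (sum-map-≥-two f p q x≢y) (m≤n+m _ (f z))

module _ {n : ℕ} where

  above : Fin n → List (Fin n)
  above u = filter (λ w → toℕ u <? toℕ w) (allFin n)

  rowSum : (Fin n → Fin n → ℕ) → Fin n → ℕ
  rowSum h u = sum (map (h u) (above u))

  -- edgeCount G is definitionally pairSum (adjℕ G)
  pairSum : (Fin n → Fin n → ℕ) → ℕ
  pairSum h = sum (map (rowSum h) (allFin n))

  SymmetricMatrix : (Fin n → Fin n → ℕ) → Set
  SymmetricMatrix h = ∀ u w → h u w ≡ h w u

  pairSum-mono : {f g : Fin n → Fin n → ℕ} → (∀ u w → f u w ≤ g u w) → pairSum f ≤ pairSum g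
  pairSum-mono f≤g = sum-map-mono (allFin n) (λ u → sum-map-mono (above u) (f≤g u))

  pairSum-+ : (f g : Fin n → Fin n → ℕ) →
              pairSum (λ u w → f u w + g u w) ≡ pairSum f + pairSum g
  pairSum-+ f g = trans (cong sum (map-cong rows (allFin n))) (sum-map-+ (rowSum f) (rowSum g) (allFin n))
    where
      rows : ∀ u → rowSum (λ u w → f u w + g u w) u ≡ rowSum f u + rowSum g u
      rows u = sum-map-+ (f u) (g u) (above u)

  ∈-above : {u w : Fin n} → toℕ u < toℕ w → w ∈ₗ above u
  ∈-above {u} {w} = ∈-filter⁺ (λ w → toℕ u <? toℕ w) (∈-allFin w)

  rowSum-≥ : (h : Fin n → Fin n → ℕ) {u w : Fin n} → toℕ u < toℕ w → h u w ≤ rowSum h u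
  rowSum-≥ h u<w = sum-map-≥-∈ (h _) (∈-above u<w)

  rowSum-≥-sym : {h : Fin n → Fin n → ℕ} → SymmetricMatrix h →
                 {u w : Fin n} → toℕ w < toℕ u → h u w ≤ rowSum h w
  rowSum-≥-sym {h} sym {u} {w} w<u = subst (_≤ rowSum h w) (sym w u) (rowSum-≥ h w<u)

  pairSum-≥-rows : (h : Fin n → Fin n → ℕ) {u w : Fin n} {a b : ℕ} → u ≢ w →
                   a ≤ rowSum h u → b ≤ rowSum h w → a + b ≤ pairSum h
  pairSum-≥-rows h u≢w a≤ b≤ =
    ≤-trans (+-mono-≤ a≤ b≤) (sum-map-≥-two (rowSum h) (∈-allFin _) (∈-allFin _) u≢w)

  pairSum-≥-two : {h : Fin n → Fin n → ℕ} → SymmetricMatrix h → {v x y : Fin n} →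
                  v ≢ x → v ≢ y → x ≢ y → h v x + h v y ≤ pairSum h
  pairSum-≥-two {h} sym {v} {x} {y} v≢x v≢y x≢y with <-cmpᶠ v x | <-cmpᶠ v y
  ... | tri≈ _ v≡x _ | _            = contradiction v≡x v≢x
  ... | _            | tri≈ _ v≡y _ = contradiction v≡y v≢y
  ... | tri< v<x _ _ | tri< v<y _ _ =
    ≤-trans (sum-map-≥-two (h v) (∈-above v<x) (∈-above v<y) x≢y)
            (sum-map-≥-∈ (rowSum h) (∈-allFin v))
  ... | tri< v<x _ _ | tri> _ _ y<v =
    pairSum-≥-rows h v≢y (rowSum-≥ h v<x) (rowSum-≥-sym sym y<v)
  ... | tri> _ _ x<v | tri< v<y _ _ =
    pairSum-≥-rows h (v≢x ∘ ≡-sym) (rowSum-≥-sym sym x<v) (rowSum-≥ h v<y)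
  ... | tri> _ _ x<v | tri> _ _ y<v =
    pairSum-≥-rows h x≢y (rowSum-≥-sym sym x<v) (rowSum-≥-sym sym y<v)

  pairSum-≥ : {h : Fin n → Fin n → ℕ} → SymmetricMatrix h → {u w : Fin n} → u ≢ w →
              h u w ≤ pairSum h
  pairSum-≥ {h} sym {u} {w} u≢w with <-cmpᶠ u w
  ... | tri< u<w _ _ = ≤-trans (rowSum-≥ h u<w) (sum-map-≥-∈ (rowSum h) (∈-allFin u))
  ... | tri≈ _ u≡w _ = contradiction u≡w u≢w
  ... | tri> _ _ w<u = ≤-trans (rowSum-≥-sym sym w<u) (sum-map-≥-∈ (rowSum h) (∈-allFin w))

module _ {n : ℕ} where

  record _⊑_ (H G : Graph n) : Set where
    constructor subgraph
    field ⊑-adj : ∀ {u v} → Adj H u v → Adj G u v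

  open _⊑_

  adjℕ : Graph n → Fin n → Fin n → ℕ
  adjℕ G u v = if adj G u v then 1 else 0

  adj≢ : (G : Graph n) {u v : Fin n} → Adj G u v → u ≢ v
  adj≢ G {u} uv refl with trans (≡-sym uv) (irrefl G u)
  ... | ()

  Adj-sym : (G : Graph n) {u v : Fin n} → Adj G u v → Adj G v u
  Adj-sym G {u} {v} uv = trans (sym G v u) uv

  walk-crosses : {G : Graph n} {ℓ : Level} {P : Pred (Fin n) ℓ} → Decidable P → {u w : Fin n} →
                 Walk G u w → P u → ¬ P w → ∃₂ λ s v → P s × ¬ P v × Adj G s v
  walk-crosses P? here Pu ¬Pw = contradiction Pu ¬Pw
  walk-crosses P? {u} (step {v = v} uv rest) Pu ¬Pw with P? v
  ... | yes Pv = walk-crosses P? rest Pv ¬Pw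
  ... | no ¬Pv = u , v , Pu , ¬Pv , uv

  adjℕ-mono : {H G : Graph n} → H ⊑ G → ∀ u v → adjℕ H u v ≤ adjℕ G u v
  adjℕ-mono {H} H⊑G u v with adj H u v in uv
  ... | true  rewrite ⊑-adj H⊑G uv = ≤-refl
  ... | false = z≤n

  edgeCount-mono : {H G : Graph n} → H ⊑ G → edgeCount H ≤ edgeCount G
  edgeCount-mono H⊑G = pairSum-mono (adjℕ-mono H⊑G)

  module NewEdges {H G : Graph n} (H⊑G : H ⊑ G) where

    new : Fin n → Fin n → ℕ
    new u v = adjℕ G u v ∸ adjℕ H u v

    new-symmetric : SymmetricMatrix new
    new-symmetric u v =
      cong₂ (λ a b → (if a then 1 else 0) ∸ (if b then 1 else 0)) (sym G u v) (sym H u v)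

    new≡1 : {u v : Fin n} → Adj G u v → ¬ Adj H u v → new u v ≡ 1
    new≡1 uv ¬uv rewrite uv | ¬-not ¬uv = refl

    edgeCount-+-new : edgeCount H + pairSum new ≤ edgeCount G
    edgeCount-+-new = ≤-trans (≤-reflexive (≡-sym (pairSum-+ (adjℕ H) new)))
      (pairSum-mono (λ u v → ≤-reflexive (m+[n∸m]≡n (adjℕ-mono H⊑G u v))))

  edgeCount-gain₁ : {H G : Graph n} → H ⊑ G → {v x : Fin n} →
                    Adj G v x → ¬ Adj H v x → edgeCount H + 1 ≤ edgeCount G
  edgeCount-gain₁ {H} {G} H⊑G vx ¬vx = ≤-trans
    (+-monoʳ-≤ (edgeCount H)
      (subst (_≤ pairSum new) (new≡1 vx ¬vx) (pairSum-≥ new-symmetric (adj≢ G vx))))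
    edgeCount-+-new
    where open NewEdges H⊑G

  edgeCount-gain₂ : {H G : Graph n} → H ⊑ G → {v x y : Fin n} →
                    Adj G v x → ¬ Adj H v x → Adj G v y → ¬ Adj H v y → x ≢ y →
                    edgeCount H + 2 ≤ edgeCount G
  edgeCount-gain₂ {H} {G} H⊑G vx ¬vx vy ¬vy x≢y = ≤-trans
    (+-monoʳ-≤ (edgeCount H) (subst (_≤ pairSum new) (cong₂ _+_ (new≡1 vx ¬vx) (new≡1 vy ¬vy))
      (pairSum-≥-two new-symmetric (adj≢ G vx) (adj≢ G vy) x≢y)))
    edgeCount-+-new
    where open NewEdges H⊑G

∣p∪q∣≤∣p∣+∣q∣ : ∀ {n} (p q : Subset n) → ∣ p ∪ q ∣ ≤ ∣ p ∣ + ∣ q ∣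
∣p∪q∣≤∣p∣+∣q∣ []            []            = z≤n
∣p∪q∣≤∣p∣+∣q∣ (true  ∷ p) (b     ∷ q) =
  s≤s (≤-trans (∣p∪q∣≤∣p∣+∣q∣ p q) (+-monoʳ-≤ ∣ p ∣ (∣p∣≤∣x∷p∣ b q)))
∣p∪q∣≤∣p∣+∣q∣ (false ∷ p) (true  ∷ q) =
  ≤-trans (s≤s (∣p∪q∣≤∣p∣+∣q∣ p q)) (≤-reflexive (≡-sym (+-suc ∣ p ∣ ∣ q ∣)))
∣p∪q∣≤∣p∣+∣q∣ (false ∷ p) (false ∷ q) = ∣p∪q∣≤∣p∣+∣q∣ p q

module _ {n : ℕ} where

  infixl 6 _⊕_
  _⊕_ : Subset n → Fin n → Subset n
  S ⊕ v = S ∪ ⁅ v ⁆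

  ∈-⊕ : (S : Subset n) (v : Fin n) → v ∈ S ⊕ v
  ∈-⊕ S v = x∈p∪q⁺ (inj₂ (x∈⁅x⁆ v))

  ⊆-⊕ : (S : Subset n) (v : Fin n) → S ⊆ S ⊕ v
  ⊆-⊕ S v = p⊆p∪q ⁅ v ⁆

  ∉-⊕ : {S : Subset n} {x v : Fin n} → x ∉ S → x ≢ v → x ∉ S ⊕ v
  ∉-⊕ {S} {x} {v} x∉S x≢v x∈S⊕v with x∈p∪q⁻ S ⁅ v ⁆ x∈S⊕v
  ... | inj₁ x∈S  = x∉S x∈S
  ... | inj₂ x∈⁅v⁆ = x≢v (x∈⁅y⁆⇒x≡y v x∈⁅v⁆)

  ⊂-⊕ : {S : Subset n} {v : Fin n} → v ∉ S → S ⊂ S ⊕ v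
  ⊂-⊕ {S} {v} v∉S = ⊆-⊕ S v , v , ∈-⊕ S v , v∉S

  ∣⊕∣≤ : (S : Subset n) (v : Fin n) → ∣ S ⊕ v ∣ ≤ ∣ S ∣ + 1
  ∣⊕∣≤ S v = subst (λ k → ∣ S ⊕ v ∣ ≤ ∣ S ∣ + k) (∣⁅x⁆∣≡1 v) (∣p∪q∣≤∣p∣+∣q∣ S ⁅ v ⁆)

  induced : Graph n → Subset n → Graph n
  induced G S = record
    { adj    = λ u v → (does (u ∈? S) ∧ does (v ∈? S)) ∧ adj G u v
    ; sym    = λ u v → cong₂ _∧_ (∧-comm (does (u ∈? S)) _) (sym G u v)
    ; irrefl = λ v → trans (cong (_ ∧_) (irrefl G v)) (∧-zeroʳ _)
    }

  module _ {G : Graph n} {S : Subset n} where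

    Adj-induced⁺ : {u v : Fin n} → u ∈ S → v ∈ S → Adj G u v → Adj (induced G S) u v
    Adj-induced⁺ {u} {v} u∈S v∈S uv =
      cong₂ _∧_ (cong₂ _∧_ (dec-true (u ∈? S) u∈S) (dec-true (v ∈? S) v∈S)) uv

    Adj-induced⁻ : {u v : Fin n} → Adj (induced G S) u v → u ∈ S × v ∈ S × Adj G u v
    Adj-induced⁻ {u} {v} uv with u ∈? S | v ∈? S
    ... | yes u∈S | yes v∈S = u∈S , v∈S , uv

    ¬Adj-induced : {u v : Fin n} → u ∉ S → ¬ Adj (induced G S) u v
    ¬Adj-induced {u} u∉S rewrite dec-false (u ∈? S) u∉S = λ ()

  induced-⊑ : (G : Graph n) (S : Subset n) → induced G S ⊑ G
  induced-⊑ G S = subgraph λ uv → let (_ , _ , uv′) = Adj-induced⁻ {G = G} {S} uv in uv′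

  induced-mono : (G : Graph n) {S S′ : Subset n} → S ⊆ S′ → induced G S ⊑ induced G S′
  induced-mono G {S} {S′} S⊆S′ = subgraph λ uv →
    let (u∈S , v∈S , uv′) = Adj-induced⁻ {G = G} {S} uv
    in  Adj-induced⁺ {G = G} (S⊆S′ u∈S) (S⊆S′ v∈S) uv′

module Growing {n : ℕ} (G : Graph n) where

  edgesWithin : Subset n → ℕ
  edgesWithin S = edgeCount (induced G S)

  record Growth (S : Subset n) (k g : ℕ) (S′ : Subset n) : Set where
    field
      strict   : S ⊂ S′
      vertices : ∣ S′ ∣ ≤ ∣ S ∣ + k
      edges    : edgesWithin S + g ≤ edgesWithin S′

  open Growth

  infixl 5 _⨾_
  _⨾_ : ∀ {S S′ S″ k k′ g g′} →
        Growth S k g S′ → Growth S′ k′ g′ S″ → Growth S (k + k′) (g + g′) S″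
  _⨾_ {S = S} {k = k} {k′} {g} {g′} γ γ′ = record
    { strict   = ⊂-trans (strict γ) (strict γ′)
    ; vertices = ≤-trans (vertices γ′)
                         (≤-trans (+-monoˡ-≤ k′ (vertices γ)) (≤-reflexive (+-assoc ∣ S ∣ k k′)))
    ; edges    = ≤-trans (≤-reflexive (≡-sym (+-assoc (edgesWithin S) g g′)))
                         (≤-trans (+-monoˡ-≤ g′ (edges γ)) (edges γ′))
    }

  attach : {S : Subset n} {v : Fin n} {g : ℕ} → v ∉ S →
           edgesWithin S + g ≤ edgesWithin (S ⊕ v) → Growth S 1 g (S ⊕ v)
  attach {S} {v} v∉S gain = record { strict = ⊂-⊕ v∉S ; vertices = ∣⊕∣≤ S v ; edges = gain }

  attach₀ : {S : Subset n} {v : Fin n} → v ∉ S → Growth S 1 0 (S ⊕ v)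
  attach₀ {S} {v} v∉S =
    attach v∉S (≤-trans (≤-reflexive (+-identityʳ _)) (edgeCount-mono (induced-mono G (⊆-⊕ S v))))

  new-edge : {S : Subset n} {v x : Fin n} → v ∉ S → x ∈ S → Adj G v x →
             Adj (induced G (S ⊕ v)) v x
  new-edge {S} {v} v∉S x∈S vx = Adj-induced⁺ {G = G} (∈-⊕ S v) (⊆-⊕ S v x∈S) vx

  attach₁ : {S : Subset n} {v x : Fin n} → v ∉ S → x ∈ S → Adj G v x → Growth S 1 1 (S ⊕ v)
  attach₁ {S} {v} {x} v∉S x∈S vx = attach v∉S (edgeCount-gain₁ (induced-mono G (⊆-⊕ S v))
    (new-edge v∉S x∈S vx) (¬Adj-induced {G = G} {S} {v} {x} v∉S))

  attach₂ : {S : Subset n} {v x y : Fin n} → v ∉ S → x ∈ S → y ∈ S →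
            Adj G v x → Adj G v y → x ≢ y → Growth S 1 2 (S ⊕ v)
  attach₂ {S} {v} {x} {y} v∉S x∈S y∈S vx vy x≢y =
    attach v∉S (edgeCount-gain₂ (induced-mono G (⊆-⊕ S v))
      (new-edge v∉S x∈S vx) (¬Adj-induced {G = G} {S} {v} {x} v∉S)
      (new-edge v∉S y∈S vy) (¬Adj-induced {G = G} {S} {v} {y} v∉S) x≢y)

  excess-growth : ∀ {S S′ k g c d} → Growth S k g S′ →
                  4 * ∣ S ∣ ≤ 3 * edgesWithin S + c → 4 * k ≤ 3 * g + d →
                  4 * ∣ S′ ∣ ≤ 3 * edgesWithin S′ + (c + d)
  excess-growth {S} {S′} {k} {g} {c} {d} γ excess 4k≤ = begin
    4 * ∣ S′ ∣                         ≤⟨ *-monoʳ-≤ 4 (vertices γ) ⟩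
    4 * (∣ S ∣ + k)                    ≡⟨ *-distribˡ-+ 4 ∣ S ∣ k ⟩
    4 * ∣ S ∣ + 4 * k                  ≤⟨ +-mono-≤ excess 4k≤ ⟩
    3 * edgesWithin S + c + (3 * g + d) ≡⟨ regroup (edgesWithin S) g c d ⟩
    3 * (edgesWithin S + g) + (c + d)  ≤⟨ +-monoˡ-≤ (c + d) (*-monoʳ-≤ 3 (edges γ)) ⟩
    3 * edgesWithin S′ + (c + d)       ∎
    where
      open ≤-Reasoning
      regroup : ∀ e g c d → 3 * e + c + (3 * g + d) ≡ 3 * (e + g) + (c + d)
      regroup = solve-∀

  Dense : Subset n → Set
  Dense S = 4 * ∣ S ∣ ≤ 3 * edgesWithin S + 3

  DenseExtension : Subset n → Set
  DenseExtension S = ∃ λ S′ → S ⊂ S′ × (Dense S → Dense S′)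

  grow-dense : ∀ {S S′ k g} → Growth S k g S′ → 4 * k ≤ 3 * g → DenseExtension S
  grow-dense {S′ = S′} γ 4k≤3g =
    S′ , strict γ , λ dense → excess-growth γ dense (≤-trans 4k≤3g (m≤m+n _ 0))

  close-triangle : {S : Subset n} {x y z : Fin n} → x ∈ S → y ∉ S → z ∉ S →
                   Adj G x y → Adj G x z → Adj G y z → Growth S 2 3 (S ⊕ y ⊕ z)
  close-triangle {S} {y = y} x∈S y∉S z∉S xy xz yz =
    attach₁ y∉S x∈S (Adj-sym G xy) ⨾
    attach₂ (∉-⊕ z∉S (adj≢ G (Adj-sym G yz))) (⊆-⊕ S y x∈S) (∈-⊕ S y)
            (Adj-sym G xz) (Adj-sym G yz) (adj≢ G xy)

  extend : TriangleCovered G → {S : Subset n} {s v : Fin n} → s ∈ S → v ∉ S → Adj G s v →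
           DenseExtension S
  extend covered {S} {v = v} s∈S v∉S sv with covered v
  ... | a , b , va , vb , ab with a ∈? S | b ∈? S
  ... | yes a∈S | yes b∈S = grow-dense (attach₂ v∉S a∈S b∈S va vb (adj≢ G ab)) (m≤m+n 4 2)
  ... | yes a∈S | no  b∉S = grow-dense (close-triangle a∈S v∉S b∉S (Adj-sym G va) ab vb) (n≤1+n 8)
  ... | no  a∉S | yes b∈S =
    grow-dense (close-triangle b∈S v∉S a∉S (Adj-sym G vb) (Adj-sym G ab) va) (n≤1+n 8)
  ... | no  a∉S | no  b∉S = grow-dense
    (attach₁ v∉S s∈S (Adj-sym G sv) ⨾
     close-triangle (∈-⊕ S v) (∉-⊕ a∉S (adj≢ G (Adj-sym G va))) (∉-⊕ b∉S (adj≢ G (Adj-sym G vb)))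
                    va vb ab)
    ≤-refl

  full-bound : {S : Subset n} → (∀ x → x ∈ S) → Dense S → 4 * n ≤ 3 * edgeCount G + 3
  full-bound {S} all∈S dense = begin
    4 * n                      ≡⟨ cong (4 *_) (∣⊤∣≡n n) ⟨
    4 * ∣ ⊤ {n = n} ∣          ≤⟨ *-monoʳ-≤ 4 (p⊆q⇒∣p∣≤∣q∣ {p = ⊤} (λ {x} _ → all∈S x)) ⟩
    4 * ∣ S ∣                  ≤⟨ dense ⟩
    3 * edgesWithin S + 3      ≤⟨ +-monoˡ-≤ 3 (*-monoʳ-≤ 3 (edgeCount-mono (induced-⊑ G S))) ⟩
    3 * edgeCount G + 3        ∎
    where open ≤-Reasoning

  module _ (connected : Connected G) (covered : TriangleCovered G) where

    fill : {S : Subset n} {s : Fin n} → s ∈ S → Dense S → Acc _⊃_ S → 4 * n ≤ 3 * edgeCount G + 3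
    fill {S} {s} s∈S dense (acc larger) with all? (_∈? S)
    ... | yes all∈S = full-bound all∈S dense
    ... | no ¬all∈S with ¬∀⟶∃¬ n _ (_∈? S) ¬all∈S
    ... | u , u∉S with walk-crosses (_∈? S) (connected s u) s∈S u∉S
    ... | s′ , v , s′∈S , v∉S , s′v with extend covered s′∈S v∉S s′v
    ... | S′ , S⊂S′ , dense′ = fill (proj₁ S⊂S′ s∈S) (dense′ dense) (larger S⊂S′)

    4*n≤3*edgeCount+3 : Fin n → 4 * n ≤ 3 * edgeCount G + 3
    4*n≤3*edgeCount+3 t with covered t
    ... | a , b , ta , tb , ab =
      fill (proj₁ (strict closing) (∈-⊕ ⊥ t)) (excess-growth (attach₀ ∉⊥ ⨾ closing) empty ≤-refl)
           (⊃-wellFounded _)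
      where
        closing : Growth (⊥ ⊕ t) 2 3 (⊥ ⊕ t ⊕ a ⊕ b)
        closing = close-triangle (∈-⊕ ⊥ t) (∉-⊕ ∉⊥ (adj≢ G (Adj-sym G ta))) (∉-⊕ ∉⊥ (adj≢ G (Adj-sym G tb)))
                                 ta tb ab
        empty : 4 * ∣ ⊥ {n = n} ∣ ≤ 3 * edgesWithin ⊥ + 0
        empty = ≤-trans (≤-reflexive (cong (4 *_) (∣⊥∣≡0 n))) z≤n

3t+1≤3e+3⇒t≤e : ∀ {t e} → 3 * t + 1 ≤ 3 * e + 3 → t ≤ e
3t+1≤3e+3⇒t≤e {t} {e} 3t+1≤3e+3 = m<1+n⇒m≤n (*-cancelˡ-< 3 t (suc e) 3t<3[1+e])
  where
    3t<3[1+e] : 3 * t < 3 * suc e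
    3t<3[1+e] = subst₂ _≤_ (+-comm (3 * t) 1) (trans (+-comm (3 * e) 3) (≡-sym (*-suc 3 e))) 3t+1≤3e+3

-- for q = suc q′ the left-hand side computes to 3 * (q′ + 3 * q + ε r) + 1,
-- whence the shape of the identities below
3*[4q∸1+εr]+1≤4*[3q+r] : ∀ q r → 1 ≤ q → r < 3 → 3 * (4 * q ∸ 1 + ε r) + 1 ≤ 4 * (3 * q + r)
3*[4q∸1+εr]+1≤4*[3q+r] (suc q) 0 _ _ = ≤-trans (m≤m+n _ 2) (≤-reflexive (identity q))
  where
    identity : ∀ q → 3 * (q + 3 * suc q + 0) + 1 + 2 ≡ 4 * (3 * suc q + 0)
    identity = solve-∀
3*[4q∸1+εr]+1≤4*[3q+r] (suc q) 1 _ _ = ≤-reflexive (identity q)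
  where
    identity : ∀ q → 3 * (q + 3 * suc q + 2) + 1 ≡ 4 * (3 * suc q + 1)
    identity = solve-∀
3*[4q∸1+εr]+1≤4*[3q+r] (suc q) 2 _ _ = ≤-trans (m≤m+n _ 1) (≤-reflexive (identity q))
  where
    identity : ∀ q → 3 * (q + 3 * suc q + 3) + 1 + 1 ≡ 4 * (3 * suc q + 2)
    identity = solve-∀
3*[4q∸1+εr]+1≤4*[3q+r] (suc q) (suc (suc (suc r))) _ 3+r<3 = contradiction 3+r<3 (m+n≮m 3 r)

theorem1p1 : ∀ (n q r : ℕ) (G : Graph n) →
    Connected G → TriangleCovered G →
    n ≡ 3 * q + r → 1 ≤ q → r < 3 → 3 < n →
    4 * q ∸ 1 + ε r ≤ edgeCount G
theorem1p1 n q r G connected covered refl 1≤q r<3 3<n =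
  3t+1≤3e+3⇒t≤e (≤-trans (3*[4q∸1+εr]+1≤4*[3q+r] q r 1≤q r<3)
                         (4*n≤3*edgeCount+3 connected covered (fromℕ< 3<n)))
  where open Growing G
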